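{- Let $m\ge1$, let $\{a_n\}_{n\ge0}$ be the $m$-gonal sequence, and for $n,k\ge0$ let $p_{n,k}$ be the number of integers in $[0,a_{mn+1})$ whose legal $m$-gonal decomposition has exactly $k$ summands. If $0<k<n+1$, then $p_{n,k}=m\,p_{n-1,k-1}+p_{n-1,k}$.
   Context: Bins of an increasing sequence $\{a_n\}_{n\ge0}$: $b_0=[a_0]$, $b_k=[a_{m(k-1)+1},\dots,a_{mk}]$ for $k\ge1$. A legal $m$-gonal decomposition of $z$ is $z=a_{\ell_t}+\cdots+a_{\ell_1}$ with $\ell_1<\cdots<\ell_t$ and no two summands in the same bin ($0$ has the empty decomposition). The $m$-gonal sequence: each $a_i$ is the smallest positive integer with no legal $m$-gonal decomposition using only $a_0,\dots,a_{i-1}$. Every nonnegative integer has a unique legal $m$-gonal decomposition in terms of this sequence. -}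

module Defs where

open import Data.Nat using (ℕ; zero; suc; _+_; _*_; _∸_; _/_; _<_; _≟_; NonZero)
open import Data.Nat.Properties using (_<?_)
open import Data.List using (List; []; _∷_; map; length; upTo; filter; _++_)
open import Data.Nat.ListAction using (sum)
open import Data.Bool.ListAction using (any)
open import Data.List.Relation.Unary.AllPairs using (AllPairs; allPairs?)
open import Data.List.Relation.Unary.Any using (Any)
open import Data.List.Membership.DecPropositional _≟_ using (_∈?_)
open import Data.Product using (_×_)
open import Data.Bool using (Bool; true; false; if_then_else_)
open import Relation.Nullary using (¬_; Dec; yes; no; does)
open import Relation.Nullary.Decidable using (¬?; _×-dec_)
open import Relation.Binary.PropositionalEquality using (_≡_; _≢_)

-- Bin index of the term a_i:  b_0 = [a_0],  b_k = [a_{m(k-1)+1}, …, a_{mk}] for k ≥ 1.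
-- So a_0 is in bin 0 and a_{j+1} is in bin (j / m) + 1.
bin : (m : ℕ) → .{{NonZero m}} → ℕ → ℕ
bin m zero    = zero
bin m (suc j) = suc (j / m)

-- All sublists (order preserved) of a list; applied to upTo i this enumerates all
-- strictly increasing index lists ℓ₁ < ⋯ < ℓ_t with all ℓ_j < i.
sublists : List ℕ → List (List ℕ)
sublists []       = [] ∷ []
sublists (x ∷ xs) = let r = sublists xs in map (x ∷_) r ++ r

LegalIdx : (m : ℕ) → .{{NonZero m}} → List ℕ → Set
LegalIdx m ℓs = AllPairs _≢_ (map (bin m) ℓs)

legalIdx? : (m : ℕ) → .{{_ : NonZero m}} → (ℓs : List ℕ) → Dec (LegalIdx m ℓs)
legalIdx? m ℓs = allPairs? (λ x y → ¬? (x ≟ y)) (map (bin m) ℓs)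

legalIdxLists : (m : ℕ) → .{{NonZero m}} → ℕ → List (List ℕ)
legalIdxLists m i = filter (legalIdx? m) (sublists (upTo i))

valueIn : List ℕ → List ℕ → ℕ
valueIn terms ℓs = sum (map (λ ℓ → nth terms ℓ) ℓs)
  where
  nth : List ℕ → ℕ → ℕ
  nth []       _       = 0
  nth (x ∷ _)  zero    = x
  nth (_ ∷ xs) (suc n) = nth xs n

-- Smallest positive integer not in the list L (searching 1, 2, …; L has at most
-- length L elements, so length L + 1 steps suffice).
leastPosNotIn : List ℕ → ℕ
leastPosNotIn L = go (suc (length L)) 1
  where
  go : ℕ → ℕ → ℕ
  go zero    z = z
  go (suc f) z = if does (z ∈? L) then go f (suc z) else z

-- The first i terms a_0, …, a_{i-1} of the m-gonal sequence: a_i is the smallest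
-- positive integer with no legal decomposition using only a_0, …, a_{i-1}.
prefix : (m : ℕ) → .{{NonZero m}} → ℕ → List ℕ
prefix m zero    = []
prefix m (suc i) =
  let P = prefix m i in
  P ++ (leastPosNotIn (map (valueIn P) (legalIdxLists m i)) ∷ [])

mgonal : (m : ℕ) → .{{NonZero m}} → ℕ → ℕ
mgonal m i = valueIn (prefix m (suc i)) (i ∷ [])

-- Since a_i ≥ i + 1, any summand a_ℓ of a decomposition of z has ℓ < z,
-- so searching index lists with indices < suc z loses nothing.
decompWith? : (m : ℕ) → .{{NonZero m}} → ℕ → ℕ → Bool
decompWith? m k z =
  any (λ ℓs → does (length ℓs ≟ k) Data.Bool.∧ does (sum (map (mgonal m) ℓs) ≟ z))
      (legalIdxLists m (suc z))
  where import Data.Bool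

p : (m : ℕ) → .{{NonZero m}} → ℕ → ℕ → ℕ
p m n k = length (filter (λ z → decompWith? m k z Data.Bool.≟ true) (upTo (mgonal m (m * n + 1))))
  where import Data.Bool

module Submission where

-- The m-gonal sequence has the closed form a 0 = 1 and a (mn + r + 1) = (r + 1) · M n for r < m, where
-- M n = 2 (m + 1)ⁿ. Indeed, the values of the legal decompositions using only a 0, …, a (i - 1) are exactly
-- the numbers below a i: greedily taking the largest possible summand reaches each of them, and the bin
-- condition keeps every legal sum below a i. Hence a (mn + 1) = M n, and [0, M (n + 1)) is [0, M n)
-- followed by the m blocks [(c + 1) M n, (c + 2) M n), c < m. The largest summand of a decomposition of
-- (c + 1) M n + w with w < M n must be a (mn + c + 1), so this number has a decomposition with k + 1
-- summands exactly when w has one with k summands.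

open import Defs
open import Data.Bool using (Bool; true; false; T; if_then_else_)
import Data.Bool as Bool
open import Data.Bool.Properties using (T-≡; ⇔→≡)
open import Data.Empty using (⊥-elim)
open import Data.Fin using (toℕ)
open import Data.Fin.Properties using (toℕ<n; pigeonhole)
open import Data.List using (List; []; _∷_; [_]; _++_; _∷ʳ_; map; length; filter; lookup; upTo; applyUpTo)
open import Data.List.Properties using (length-++; map-++; filter-++; upTo-∷ʳ; applyUpTo-∷ʳ; map-cong)
open import Data.List.Membership.Propositional using (_∈_; _∉_; find; lose)
open import Data.List.Membership.Propositional.Properties
  using (∈-++⁻; ∈-++⁺ˡ; ∈-++⁺ʳ; ∈-map⁺; ∈-map⁻; ∈-filter⁺; ∈-filter⁻)
open import Data.List.Relation.Unary.All as All using (All; []; _∷_)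
open import Data.List.Relation.Unary.All.Properties using (++⁺; ++⁻; ++⁻ʳ; map⁺; map⁻)
open import Data.List.Relation.Unary.AllPairs using (AllPairs; []; _∷_)
import Data.List.Relation.Unary.AllPairs.Properties as AllPairs
open import Data.List.Relation.Unary.Any using (here; there; index)
open import Data.List.Relation.Unary.Any.Properties using (any⁺; any⁻; lookup-index)
open import Data.Nat
open import Data.List.Membership.DecPropositional _≟_ using (_∈?_)
open import Data.Nat.DivMod
  using (m≡m%n+[m/n]*n; m%n<n; [m+kn]%n≡m%n; m<n⇒m%n≡m; m<n⇒m/n≡0; m*n/n≡m; +-distrib-/-∣ʳ; m<n*o⇒m/o<n)
open import Data.Nat.Divisibility using (divides-refl)
open import Data.Nat.Induction using (<-wellFounded)
open import Data.Nat.ListAction using (sum)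
open import Data.Nat.ListAction.Properties using (sum-++)
open import Data.Nat.Properties
open import Data.Product using (∃-syntax; ∃₂; _×_; _,_; map₁)
open import Data.Sum using (_⊎_; inj₁; inj₂)
import Data.Sum as Sum
open import Data.Unit using (tt)
open import Function using (_∘_; _∋_; _⇔_; mk⇔; Equivalence)
open import Induction.WellFounded using (Acc; acc)
open import Relation.Binary.PropositionalEquality
  using (_≡_; _≢_; refl; sym; trans; cong; cong₂; subst; subst₂; module ≡-Reasoning)
open import Relation.Nullary using (Dec; yes; no; does; contradiction; _×-dec_)

private
  variable
    A : Set
    i j k n r z c w x : ℕ
    ys zs : List ℕ

length-∷ʳ : ∀ (xs : List A) x → length (xs ∷ʳ x) ≡ suc (length xs)
length-∷ʳ xs x = trans (length-++ xs) (+-comm (length xs) 1)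

sum-map-∷ʳ : ∀ (f : A → ℕ) xs x → sum (map f (xs ∷ʳ x)) ≡ sum (map f xs) + f x
sum-map-∷ʳ f xs x = begin
  sum (map f (xs ∷ʳ x))          ≡⟨ cong sum (map-++ f xs [ x ]) ⟩
  sum (map f xs ++ [ f x ])      ≡⟨ sum-++ (map f xs) [ f x ] ⟩
  sum (map f xs) + (f x + 0)     ≡⟨ cong (sum (map f xs) +_) (+-identityʳ (f x)) ⟩
  sum (map f xs) + f x           ∎
  where open ≡-Reasoning

≤-sum-map : ∀ (f : A → ℕ) xs → All (λ x → f x ≤ sum (map f xs)) xs
≤-sum-map f []       = []
≤-sum-map f (x ∷ xs) = m≤m+n (f x) _ ∷ All.map (λ le → ≤-trans le (m≤n+m _ (f x))) (≤-sum-map f xs)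

AllPairs-∷ʳ⁻ : ∀ {R : A → A → Set} {xs x} → AllPairs R (xs ∷ʳ x) → AllPairs R xs × All (λ y → R y x) xs
AllPairs-∷ʳ⁻ {xs = []}     _          = [] , []
AllPairs-∷ʳ⁻ {xs = y ∷ xs} (px ∷ pxs) with ++⁻ xs px | AllPairs-∷ʳ⁻ pxs
... | px′ , (pyx ∷ []) | pxs′ , pxsx = (px′ ∷ pxs′) , (pyx ∷ pxsx)

AllPairs-∷ʳ⁺ : ∀ {R : A → A → Set} {xs x} → AllPairs R xs → All (λ y → R y x) xs → AllPairs R (xs ∷ʳ x)
AllPairs-∷ʳ⁺ pxs pxsx = AllPairs.++⁺ pxs ([] ∷ []) (All.map (_∷ []) pxsx)

range⊆⇒≤length : ∀ {N} (xs : List ℕ) → (∀ {z} → z < N → z ∈ xs) → N ≤ length xs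
range⊆⇒≤length xs ⊆xs = ≮⇒≥ λ len<N →
  let i , j , i<j , same = pigeonhole len<N (λ k → index (⊆xs (toℕ<n k))) in
  <⇒≢ i<j (trans (lookup-index (⊆xs (toℕ<n i)))
          (trans (cong (lookup xs) same) (sym (lookup-index (⊆xs (toℕ<n j))))))

∈-sublists-∷⁻ : ∀ x xs {ys} → ys ∈ sublists (x ∷ xs) →
                (∃[ zs ] zs ∈ sublists xs × ys ≡ x ∷ zs) ⊎ ys ∈ sublists xs
∈-sublists-∷⁻ x xs p = Sum.map₁ (∈-map⁻ (x ∷_)) (∈-++⁻ (map (x ∷_) (sublists xs)) p)

∈-sublists-∷⁺ˡ : ∀ x xs → ys ∈ sublists xs → x ∷ ys ∈ sublists (x ∷ xs)
∈-sublists-∷⁺ˡ x xs = ∈-++⁺ˡ ∘ ∈-map⁺ (x ∷_)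

∈-sublists-∷⁺ʳ : ∀ x xs → ys ∈ sublists xs → ys ∈ sublists (x ∷ xs)
∈-sublists-∷⁺ʳ x xs = ∈-++⁺ʳ (map (x ∷_) (sublists xs))

∈-sublists-∷ʳ⁻ : ∀ xs x {ys} → ys ∈ sublists (xs ∷ʳ x) →
                 ys ∈ sublists xs ⊎ ∃[ zs ] zs ∈ sublists xs × ys ≡ zs ∷ʳ x
∈-sublists-∷ʳ⁻ []       x (here refl)         = inj₂ ([] , here refl , refl)
∈-sublists-∷ʳ⁻ []       x (there (here refl)) = inj₁ (here refl)
∈-sublists-∷ʳ⁻ (y ∷ xs) x p with ∈-sublists-∷⁻ y (xs ∷ʳ x) p
... | inj₂ q = Sum.map (∈-sublists-∷⁺ʳ y xs) (λ (zs , r , eq) → zs , ∈-sublists-∷⁺ʳ y xs r , eq)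
                       (∈-sublists-∷ʳ⁻ xs x q)
... | inj₁ (ws , q , refl) with ∈-sublists-∷ʳ⁻ xs x q
...   | inj₁ r               = inj₁ (∈-sublists-∷⁺ˡ y xs r)
...   | inj₂ (zs , r , refl) = inj₂ (y ∷ zs , ∈-sublists-∷⁺ˡ y xs r , refl)

∈-sublists-∷ʳ⁺ˡ : ∀ xs x → ys ∈ sublists xs → ys ∷ʳ x ∈ sublists (xs ∷ʳ x)
∈-sublists-∷ʳ⁺ˡ []       x (here refl) = here refl
∈-sublists-∷ʳ⁺ˡ (y ∷ xs) x p with ∈-sublists-∷⁻ y xs p
... | inj₁ (zs , q , refl) = ∈-sublists-∷⁺ˡ y (xs ∷ʳ x) (∈-sublists-∷ʳ⁺ˡ xs x q)
... | inj₂ q               = ∈-sublists-∷⁺ʳ y (xs ∷ʳ x) (∈-sublists-∷ʳ⁺ˡ xs x q)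

∈-sublists-∷ʳ⁺ʳ : ∀ xs x → ys ∈ sublists xs → ys ∈ sublists (xs ∷ʳ x)
∈-sublists-∷ʳ⁺ʳ []       x (here refl) = there (here refl)
∈-sublists-∷ʳ⁺ʳ (y ∷ xs) x p with ∈-sublists-∷⁻ y xs p
... | inj₁ (zs , q , refl) = ∈-sublists-∷⁺ˡ y (xs ∷ʳ x) (∈-sublists-∷ʳ⁺ʳ xs x q)
... | inj₂ q               = ∈-sublists-∷⁺ʳ y (xs ∷ʳ x) (∈-sublists-∷ʳ⁺ʳ xs x q)

-- A record rather than an abbreviation, so that `i` can be inferred from a proof of `Subseq i ys`.
record Subseq (i : ℕ) (ys : List ℕ) : Set where
  constructor subseq
  field ∈sublists : ys ∈ sublists (upTo i)

subseq-suc : ys ∈ sublists (upTo i ∷ʳ i) → Subseq (suc i) ys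
subseq-suc {ys} {i} = subseq ∘ subst (λ l → ys ∈ sublists l) (upTo-∷ʳ i)

subseq-suc⁻ : Subseq (suc i) ys → Subseq i ys ⊎ ∃[ zs ] Subseq i zs × ys ≡ zs ∷ʳ i
subseq-suc⁻ {i} {ys} (subseq s)
  with ∈-sublists-∷ʳ⁻ (upTo i) i (subst (λ l → ys ∈ sublists l) (sym (upTo-∷ʳ i)) s)
... | inj₁ s′             = inj₁ (subseq s′)
... | inj₂ (zs , s′ , eq) = inj₂ (zs , subseq s′ , eq)

subseq-suc⁺ : Subseq i ys → Subseq (suc i) ys
subseq-suc⁺ {i} (subseq s) = subseq-suc (∈-sublists-∷ʳ⁺ʳ (upTo i) i s)

subseq-∷ʳ⁺ : Subseq i ys → Subseq (suc i) (ys ∷ʳ i)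
subseq-∷ʳ⁺ {i} (subseq s) = subseq-suc (∈-sublists-∷ʳ⁺ˡ (upTo i) i s)

subseq-mono : i ≤ j → Subseq i ys → Subseq j ys
subseq-mono = go ∘ ≤⇒≤′
  where
  go : i ≤′ j → Subseq i ys → Subseq j ys
  go ≤′-refl        s = s
  go (≤′-step i≤′j) s = subseq-suc⁺ (go i≤′j s)

subseq-[] : Subseq i []
subseq-[] = subseq-mono z≤n (subseq (here refl))

subseq⇒All< : Subseq i ys → All (_< i) ys
subseq⇒All< {zero}  (subseq (here refl)) = []
subseq⇒All< {suc i} s with subseq-suc⁻ s
... | inj₁ s′               = All.map m<n⇒m<1+n (subseq⇒All< s′)
... | inj₂ (zs , s′ , refl) = ++⁺ (All.map m<n⇒m<1+n (subseq⇒All< s′)) (n<1+n i ∷ [])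

subseq-restrict : Subseq i ys → All (_< j) ys → Subseq j ys
subseq-restrict {zero}  (subseq (here refl)) _ = subseq-[]
subseq-restrict {suc i} s ys<j with subseq-suc⁻ s
... | inj₁ s′ = subseq-restrict s′ ys<j
... | inj₂ (zs , s′ , refl) with ++⁻ʳ zs ys<j
...   | i<j ∷ [] = subseq-mono i<j (subseq-∷ʳ⁺ s′)

subseq-last : Subseq i ys → ys ≡ [] ⊎ ∃₂ λ zs x → x < i × Subseq x zs × ys ≡ zs ∷ʳ x
subseq-last {zero}  (subseq (here refl)) = inj₁ refl
subseq-last {suc i} s with subseq-suc⁻ s
... | inj₂ (zs , s′ , eq) = inj₂ (zs , i , n<1+n i , s′ , eq)
... | inj₁ s′ = Sum.map₂ (λ (zs , x , x<i , s″ , eq) → zs , x , m<n⇒m<1+n x<i , s″ , eq) (subseq-last s′)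

-- `valueIn` reads its terms through a local `nth`, which can only be named as `valueIn ts [ ℓ ]`.
valueIn-∷ : ∀ ts ℓ ℓs → valueIn ts (ℓ ∷ ℓs) ≡ valueIn ts [ ℓ ] + valueIn ts ℓs
valueIn-∷ ts ℓ ℓs = cong (_+ valueIn ts ℓs) (sym (+-identityʳ _))

valueIn-applyUpTo-[] : ∀ (f : ℕ → ℕ) {i ℓ} → ℓ < i → valueIn (applyUpTo f i) [ ℓ ] ≡ f ℓ
valueIn-applyUpTo-[] f {suc i} {zero}  _          = +-identityʳ (f 0)
valueIn-applyUpTo-[] f {suc i} {suc ℓ} (s≤s ℓ<i) = valueIn-applyUpTo-[] (f ∘ suc) ℓ<i

valueIn-applyUpTo : ∀ (f : ℕ → ℕ) {i ℓs} → All (_< i) ℓs → valueIn (applyUpTo f i) ℓs ≡ sum (map f ℓs)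
valueIn-applyUpTo f []                         = refl
valueIn-applyUpTo f {i} {ℓ ∷ ℓs} (ℓ<i ∷ ℓs<i) =
  trans (valueIn-∷ (applyUpTo f i) ℓ ℓs)
        (cong₂ _+_ (valueIn-applyUpTo-[] f ℓ<i) (valueIn-applyUpTo f ℓs<i))

countBelow : (ℕ → Bool) → ℕ → ℕ
countBelow f N = length (filter (λ z → f z Bool.≟ true) (upTo N))

countBelow-suc : ∀ f N → countBelow f (suc N) ≡ countBelow f N + (if f N then 1 else 0)
countBelow-suc f N = begin
  length (filter P? (upTo (suc N)))              ≡⟨ cong (length ∘ filter P?) (sym (upTo-∷ʳ N)) ⟩
  length (filter P? (upTo N ∷ʳ N))               ≡⟨ cong length (filter-++ P? (upTo N) [ N ]) ⟩
  length (filter P? (upTo N) ++ filter P? [ N ]) ≡⟨ length-++ (filter P? (upTo N)) ⟩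
  countBelow f N + length (filter P? [ N ])      ≡⟨ cong (countBelow f N +_) singleton ⟩
  countBelow f N + (if f N then 1 else 0)        ∎
  where
  open ≡-Reasoning
  P? = λ z → f z Bool.≟ true
  singleton : length (filter P? [ N ]) ≡ (if f N then 1 else 0)
  singleton with f N
  ... | true  = refl
  ... | false = refl

countBelow-cong : ∀ {f g} N → (∀ {z} → z < N → f z ≡ g z) → countBelow f N ≡ countBelow g N
countBelow-cong zero    _   = refl
countBelow-cong {f} {g} (suc N) f≗g = begin
  countBelow f (suc N)                    ≡⟨ countBelow-suc f N ⟩
  countBelow f N + (if f N then 1 else 0) ≡⟨ cong₂ (λ c b → c + (if b then 1 else 0))
                                                  (countBelow-cong N (f≗g ∘ m<n⇒m<1+n)) (f≗g (n<1+n N)) ⟩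
  countBelow g N + (if g N then 1 else 0) ≡⟨ countBelow-suc g N ⟨
  countBelow g (suc N)                    ∎
  where open ≡-Reasoning

countBelow-+ : ∀ f a b → countBelow f (a + b) ≡ countBelow f a + countBelow (λ w → f (a + w)) b
countBelow-+ f a zero    = trans (cong (countBelow f) (+-identityʳ a)) (sym (+-identityʳ _))
countBelow-+ f a (suc b) = begin
  countBelow f (a + suc b)                             ≡⟨ cong (countBelow f) (+-suc a b) ⟩
  countBelow f (suc (a + b))                           ≡⟨ countBelow-suc f (a + b) ⟩
  countBelow f (a + b) + δ                             ≡⟨ cong (_+ δ) (countBelow-+ f a b) ⟩
  countBelow f a + countBelow g b + δ                  ≡⟨ +-assoc (countBelow f a) _ δ ⟩
  countBelow f a + (countBelow g b + δ)                ≡⟨ cong (countBelow f a +_) (countBelow-suc g b) ⟨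
  countBelow f a + countBelow g (suc b)                ∎
  where
  open ≡-Reasoning
  g = λ w → f (a + w)
  δ = if f (a + b) then 1 else 0

countBelow-* : ∀ {f g} q B → (∀ {c w} → c < q → w < B → f (c * B + w) ≡ g w) →
               countBelow f (q * B) ≡ q * countBelow g B
countBelow-* zero    B _     = refl
countBelow-* {f} {g} (suc q) B block = begin
  countBelow f (B + q * B)                            ≡⟨ countBelow-+ f B (q * B) ⟩
  countBelow f B + countBelow (λ w → f (B + w)) (q * B) ≡⟨ cong₂ _+_ (countBelow-cong B (block z<s))
                                                                   (countBelow-* q B shifted) ⟩
  countBelow g B + q * countBelow g B                 ∎
  where
  open ≡-Reasoning
  shifted : ∀ {c w} → c < q → w < B → f (B + (c * B + w)) ≡ g w
  shifted c<q w<B = trans (cong f (sym (+-assoc B _ _))) (block (s≤s c<q) w<B)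

module _ (xs : List ℕ) (search : ℕ → ℕ → ℕ)
         (search-zero : ∀ z → search 0 z ≡ z)
         (search-suc : ∀ f z → search (suc f) z ≡ (if does (z ∈? xs) then search f (suc z) else z))
         where

  search-finds : ∀ f {z x} → 0 < z → z ≤ x → x ≤ f + z →
                 (∀ {y} → 0 < y → y < x → y ∈ xs) → x ∉ xs → search f z ≡ x
  search-finds zero    {z} _   z≤x x≤z _ _ = trans (search-zero z) (≤-antisym z≤x x≤z)
  search-finds (suc f) {z} {x} 0<z z≤x x≤ below x∉ rewrite search-suc f z with z ∈? xs
  ... | yes z∈ = search-finds f z<s (≤∧≢⇒< z≤x λ { refl → x∉ z∈ }) (subst (x ≤_) (sym (+-suc f z)) x≤)
                              below x∉
  ... | no  z∉ = ≤-antisym z≤x (≮⇒≥ λ z<x → z∉ (below 0<z z<x))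

leastPosNotIn≡ : ∀ xs {x} → 0 < x → x ≤ suc (length xs) → (∀ {y} → 0 < y → y < x → y ∈ xs) →
                 x ∉ xs → leastPosNotIn xs ≡ x
leastPosNotIn≡ xs {x} 0<x x≤ below x∉ with 1 ∈? xs
... | no 1∉ = ≤-antisym 0<x (≮⇒≥ λ 1<x → 1∉ (below ≤-refl 1<x))
-- `go` is local to `leastPosNotIn`: abstracting its fuel and start point lets Agda infer it.
... | yes 1∈ with search-finds xs _ (λ _ → refl) (λ _ _ → refl) | length xs | 2
                | (0 < 2 ∋ z<s) | (2 ≤ x ∋ ≤∧≢⇒< 0<x λ { refl → x∉ 1∈ })
                | (x ≤ length xs + 2 ∋ subst (x ≤_) (+-comm 2 (length xs)) (m≤n⇒m≤1+n x≤))
...   | finds | n | two | 0<two | two≤x | x≤n+two = finds n 0<two two≤x x≤n+two below x∉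

T-does : ∀ {P : Set} (d : Dec P) → T (does d) ⇔ P
T-does (yes p) = mk⇔ (λ _ → p) (λ _ → tt)
T-does (no ¬p) = mk⇔ (λ ()) ¬p

remainder-unique : ∀ {d x y q q′} .{{_ : NonZero d}} → x < d → y < d → x + q * d ≡ y + q′ * d → x ≡ y
remainder-unique {d} {x} {y} {q} {q′} x<d y<d eq = begin
  x                ≡⟨ m<n⇒m%n≡m x<d ⟨
  x % d            ≡⟨ [m+kn]%n≡m%n x q d ⟨
  (x + q * d) % d  ≡⟨ cong (_% d) eq ⟩
  (y + q′ * d) % d ≡⟨ [m+kn]%n≡m%n y q′ d ⟩
  y % d            ≡⟨ m<n⇒m%n≡m y<d ⟩
  y                ∎
  where open ≡-Reasoning

module _ (m : ℕ) .{{_ : NonZero m}} where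

  -- M n = a (mn + 1), and `idx n r` = mn + r + 1 is the (r + 1)-st index of bin n + 1.
  M : ℕ → ℕ
  M zero    = 2
  M (suc n) = suc m * M n

  a : ℕ → ℕ
  a zero    = 1
  a (suc j) = suc (j % m) * M (j / m)

  idx : ℕ → ℕ → ℕ
  idx n r = suc (r + n * m)

  data Index : ℕ → Set where
    initial : Index 0
    idx<    : ∀ n r → r < m → Index (idx n r)

  index-of : ∀ ℓ → Index ℓ
  index-of zero    = initial
  index-of (suc j) = subst (Index ∘ suc) (sym (m≡m%n+[m/n]*n j m)) (idx< (j / m) (j % m) (m%n<n j m))

  0<M : ∀ n → 0 < M n
  0<M zero    = z<s
  0<M (suc n) = <-≤-trans (0<M n) (m≤m+n (M n) _)

  /-idx : ∀ n → r < m → (r + n * m) / m ≡ n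
  /-idx {r} n r<m = trans (+-distrib-/-∣ʳ r (divides-refl n)) (cong₂ _+_ (m<n⇒m/n≡0 r<m) (m*n/n≡m n m))

  %-idx : ∀ n → r < m → (r + n * m) % m ≡ r
  %-idx {r} n r<m = trans ([m+kn]%n≡m%n r n m) (m<n⇒m%n≡m r<m)

  a-idx : ∀ n → r < m → a (idx n r) ≡ suc r * M n
  a-idx n r<m = cong₂ (λ r′ n′ → suc r′ * M n′) (%-idx n r<m) (/-idx n r<m)

  a-first : ∀ n → a (suc (n * m)) ≡ M n
  a-first n = trans (a-idx n (>-nonZero⁻¹ m)) (+-identityʳ (M n))

  bin-idx : ∀ n → r < m → bin m (idx n r) ≡ suc n
  bin-idx n r<m = cong suc (/-idx n r<m)

  a-suc-idx : ∀ n → r < m → a (suc (idx n r)) ≡ M n + a (idx n r)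
  a-suc-idx {r} n r<m with m≤n⇒m<n∨m≡n r<m
  ... | inj₁ 1+r<m = trans (a-idx n 1+r<m) (cong (M n +_) (sym (a-idx n r<m)))
  ... | inj₂ 1+r≡m = begin
    a (suc (idx n r))      ≡⟨ cong (λ t → a (suc (t + n * m))) 1+r≡m ⟩
    a (suc (suc n * m))    ≡⟨ a-first (suc n) ⟩
    M n + m * M n          ≡⟨ cong (λ t → M n + t * M n) 1+r≡m ⟨
    M n + suc r * M n      ≡⟨ cong (M n +_) (a-idx n r<m) ⟨
    M n + a (idx n r)      ∎
    where open ≡-Reasoning

  a-<-suc : ∀ ℓ → a ℓ < a (suc ℓ)
  a-<-suc ℓ with index-of ℓ
  ... | initial       = subst (1 <_) (sym (a-first 0)) (n<1+n 1)
  ... | idx< n r r<m = subst (a (idx n r) <_) (sym (a-suc-idx n r<m)) (m<n+m _ (0<M n))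

  a-mono-≤ : i ≤ j → a i ≤ a j
  a-mono-≤ = go ∘ ≤⇒≤′
    where
    go : i ≤′ j → a i ≤ a j
    go ≤′-refl        = ≤-refl
    go (≤′-step i≤′j) = ≤-trans (go i≤′j) (<⇒≤ (a-<-suc _))

  a-cancel-< : a i < a j → i < j
  a-cancel-< ai<aj = ≰⇒> λ j≤i → <⇒≱ ai<aj (a-mono-≤ j≤i)

  n<a : ∀ ℓ → ℓ < a ℓ
  n<a zero    = z<s
  n<a (suc ℓ) = ≤-<-trans (n<a ℓ) (a-<-suc ℓ)

  bin-below : ∀ {ℓ} → ℓ < suc (n * m) → bin m ℓ < suc n
  bin-below {ℓ = zero}  _           = z<s
  bin-below {ℓ = suc j} (s≤s j<nm) = s≤s (m<n*o⇒m/o<n j<nm)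

  below-or-idx : ∀ {ℓ} → ℓ < suc (suc n * m) → ℓ < suc (n * m) ⊎ ∃[ r ] r < m × ℓ ≡ idx n r
  below-or-idx {n} {ℓ} ℓ< with ℓ <? suc (n * m)
  ... | yes ℓ<nm = inj₁ ℓ<nm
  ... | no  ℓ≮nm = inj₂ (offset , offset<m , sym idx≡ℓ)
    where
    offset = ℓ ∸ suc (n * m)
    idx≡ℓ : idx n offset ≡ ℓ
    idx≡ℓ = trans (sym (+-suc offset (n * m))) (m∸n+n≡m (≮⇒≥ ℓ≮nm))
    offset<m : offset < m
    offset<m = +-cancelʳ-≤ (n * m) (suc offset) m (subst (_≤ m + n * m) (sym idx≡ℓ) (≤-pred ℓ<))

  earlier-bin : ∀ {ℓ} → r < m → ℓ < idx n r → bin m ℓ ≢ suc n → ℓ < suc (n * m)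
  earlier-bin {r} {n} r<m ℓ< bin≢
    with below-or-idx {n} (<-≤-trans ℓ< (s≤s (+-monoˡ-≤ (n * m) (<⇒≤ r<m))))
  ... | inj₁ ℓ<nm               = ℓ<nm
  ... | inj₂ (r′ , r′<m , refl) = contradiction (bin-idx n r′<m) bin≢

  value : List ℕ → ℕ
  value ys = sum (map a ys)

  value-∷ʳ : ∀ zs x → value (zs ∷ʳ x) ≡ value zs + a x
  value-∷ʳ = sum-map-∷ʳ a

  value<a⇒All< : value ys < a i → All (_< i) ys
  value<a⇒All< {ys} v< = All.map (λ a≤v → a-cancel-< (≤-<-trans a≤v v<)) (≤-sum-map a ys)

  Legal : ℕ → List ℕ → Set
  Legal i ys = Subseq i ys × LegalIdx m ys

  legal-[] : Legal i []
  legal-[] = subseq-[] , []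

  legal-mono : i ≤ j → Legal i ys → Legal j ys
  legal-mono i≤j = map₁ (subseq-mono i≤j)

  legal-restrict : Legal i ys → All (_< j) ys → Legal j ys
  legal-restrict (s , lg) ys<j = subseq-restrict s ys<j , lg

  legal-bound : Legal i ys → Legal (suc (value ys)) ys
  legal-bound {ys = ys} l = legal-restrict l (value<a⇒All< (<-trans (n<1+n (value ys)) (n<a _)))

  legalIdx-∷ʳ⁻ : LegalIdx m (zs ∷ʳ x) → LegalIdx m zs × All (λ y → bin m y ≢ bin m x) zs
  legalIdx-∷ʳ⁻ {zs} {x} lg with AllPairs-∷ʳ⁻ (subst (AllPairs _≢_) (map-++ (bin m) zs [ x ]) lg)
  ... | lg′ , bins = lg′ , map⁻ bins

  legalIdx-∷ʳ⁺ : LegalIdx m zs → All (λ y → bin m y ≢ bin m x) zs → LegalIdx m (zs ∷ʳ x)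
  legalIdx-∷ʳ⁺ {zs} {x} lg bins =
    subst (AllPairs _≢_) (sym (map-++ (bin m) zs [ x ])) (AllPairs-∷ʳ⁺ lg (map⁺ bins))

  legal-∷ʳ-idx⁺ : ∀ n → r < m → Legal (suc (n * m)) zs → Legal (suc (idx n r)) (zs ∷ʳ idx n r)
  legal-∷ʳ-idx⁺ {r} n r<m (s , lg) =
    subseq-∷ʳ⁺ (subseq-mono (s≤s (m≤n+m (n * m) r)) s) ,
    legalIdx-∷ʳ⁺ lg (All.map (λ y<nm bin≡ → <⇒≢ (bin-below y<nm) (trans bin≡ (bin-idx n r<m)))
                             (subseq⇒All< s))

  legal-∷ʳ-idx⁻ : ∀ n → r < m → Subseq (idx n r) zs → LegalIdx m (zs ∷ʳ idx n r) →
                  Legal (suc (n * m)) zs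
  legal-∷ʳ-idx⁻ {r} n r<m s lg with legalIdx-∷ʳ⁻ lg
  ... | lg′ , bins = subseq-restrict s (All.zipWith in-earlier-bin (subseq⇒All< s , bins)) , lg′
    where
    in-earlier-bin : ∀ {y} → y < idx n r × bin m y ≢ bin m (idx n r) → y < suc (n * m)
    in-earlier-bin (y< , bin≢) = earlier-bin {n = n} r<m y< λ bin≡ → bin≢ (trans bin≡ (sym (bin-idx n r<m)))

  value-∷ʳ< : ∀ {x zs} → Index x → (∀ {j ys} → j ≤ x → Legal j ys → value ys < a j) →
              Subseq x zs → LegalIdx m (zs ∷ʳ x) → value (zs ∷ʳ x) < a (suc x)
  value-∷ʳ< initial _ (subseq (here refl)) _ = subst (1 <_) (sym (a-first 0)) (n<1+n 1)
  value-∷ʳ< {zs = zs} (idx< n r r<m) earlier s lg = begin-strict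
    value (zs ∷ʳ idx n r)     ≡⟨ value-∷ʳ zs (idx n r) ⟩
    value zs + a (idx n r)    <⟨ +-monoˡ-< (a (idx n r)) (subst (value zs <_) (a-first n) value<M) ⟩
    M n + a (idx n r)         ≡⟨ a-suc-idx n r<m ⟨
    a (suc (idx n r))         ∎
    where
    open ≤-Reasoning
    value<M : value zs < a (suc (n * m))
    value<M = earlier (s≤s (m≤n+m (n * m) r)) (legal-∷ʳ-idx⁻ n r<m s lg)

  value<a : Legal i ys → value ys < a i
  value<a {i} = go (<-wellFounded i)
    where
    go : ∀ {i ys} → Acc _<_ i → Legal i ys → value ys < a i
    go {i} (acc rec) (s , lg) with subseq-last s
    ... | inj₁ refl = ≤-<-trans z≤n (n<a i)
    ... | inj₂ (zs , x , x<i , s′ , refl) =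
      <-≤-trans (value-∷ʳ< (index-of x) (λ j≤x → go (rec (≤-<-trans j≤x x<i))) s′ lg) (a-mono-≤ x<i)

  decompose : ∀ i {z} → z < a i → ∃[ ys ] Legal i ys × value ys ≡ z
  decompose i = go (<-wellFounded i)
    where
    go : ∀ {i z} → Acc _<_ i → z < a i → ∃[ ys ] Legal i ys × value ys ≡ z
    go {zero}  {zero}  _ _          = [] , legal-[] , refl
    go {zero}  {suc z} _ (s≤s ())
    go {suc i} {z} (acc rec) z<a with z <? a i | index-of i
    ... | yes z<aᵢ | _ = let ys , l , eq = go (rec (n<1+n i)) z<aᵢ in ys , legal-mono (n≤1+n i) l , eq
    ... | no  z≮aᵢ | initial =
      [ 0 ] , (subseq (here refl) , [] ∷ []) ,
      ≤-antisym (≮⇒≥ z≮aᵢ) (≤-pred (subst (z <_) (a-first 0) z<a))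
    ... | no  z≮aᵢ | idx< n r r<m =
      let ys , l , eq = go (rec (s≤s (s≤s (m≤n+m (n * m) r)))) rest<M
      in ys ∷ʳ idx n r , legal-∷ʳ-idx⁺ n r<m l ,
         trans (value-∷ʳ ys _) (trans (cong (_+ a (idx n r)) eq) (m∸n+n≡m aᵢ≤z))
      where
      aᵢ≤z : a (idx n r) ≤ z
      aᵢ≤z = ≮⇒≥ z≮aᵢ
      rest<M : z ∸ a (idx n r) < a (suc (n * m))
      rest<M = subst (z ∸ a (idx n r) <_) (sym (a-first n)) (+-cancelʳ-< (a (idx n r)) _ (M n) (begin-strict
        z ∸ a (idx n r) + a (idx n r) ≡⟨ m∸n+n≡m aᵢ≤z ⟩
        z                             <⟨ z<a ⟩
        a (suc (idx n r))             ≡⟨ a-suc-idx n r<m ⟩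
        M n + a (idx n r)             ∎))
        where open ≤-Reasoning

  ∈-legalIdxLists⇔ : ys ∈ legalIdxLists m i ⇔ Legal i ys
  ∈-legalIdxLists⇔ {i = i} = mk⇔
    (λ ys∈ → let s , lg = ∈-filter⁻ (legalIdx? m) {xs = sublists (upTo i)} ys∈ in subseq s , lg)
    (λ (subseq s , lg) → ∈-filter⁺ (legalIdx? m) s lg)

  ∈-values⇔ : z ∈ map (valueIn (applyUpTo a i)) (legalIdxLists m i) ⇔ (∃[ ys ] Legal i ys × value ys ≡ z)
  ∈-values⇔ {z} {i} = mk⇔ to from
    where
    valueIn≡value : Legal i ys → valueIn (applyUpTo a i) ys ≡ value ys
    valueIn≡value (s , _) = valueIn-applyUpTo a (subseq⇒All< s)
    to : z ∈ map (valueIn (applyUpTo a i)) (legalIdxLists m i) → ∃[ ys ] Legal i ys × value ys ≡ z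
    to z∈ with ∈-map⁻ (valueIn (applyUpTo a i)) z∈
    ... | ys , ys∈ , z≡ =
      let l = Equivalence.to ∈-legalIdxLists⇔ ys∈ in ys , l , sym (trans z≡ (valueIn≡value l))
    from : ∃[ ys ] Legal i ys × value ys ≡ z → z ∈ map (valueIn (applyUpTo a i)) (legalIdxLists m i)
    from (ys , l , refl) = subst (_∈ _) (valueIn≡value l) (∈-map⁺ _ (Equivalence.from ∈-legalIdxLists⇔ l))

  leastPosNotIn-values : ∀ i → leastPosNotIn (map (valueIn (applyUpTo a i)) (legalIdxLists m i)) ≡ a i
  leastPosNotIn-values i =
    leastPosNotIn≡ _ (≤-<-trans z≤n (n<a i)) (m≤n⇒m≤1+n (range⊆⇒≤length _ below)) (λ _ → below) aᵢ∉
    where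
    below : z < a i → z ∈ map (valueIn (applyUpTo a i)) (legalIdxLists m i)
    below = Equivalence.from (∈-values⇔ {i = i}) ∘ decompose i
    aᵢ∉ : a i ∉ map (valueIn (applyUpTo a i)) (legalIdxLists m i)
    aᵢ∉ aᵢ∈ = let ys , l , eq = Equivalence.to (∈-values⇔ {i = i}) aᵢ∈ in <-irrefl eq (value<a l)

  prefix≡ : ∀ i → prefix m i ≡ applyUpTo a i
  prefix≡ zero    = refl
  prefix≡ (suc i) = begin
    prefix m i ∷ʳ leastPosNotIn (map (valueIn (prefix m i)) (legalIdxLists m i))
      ≡⟨ cong (λ P → P ∷ʳ leastPosNotIn (map (valueIn P) (legalIdxLists m i))) (prefix≡ i) ⟩
    applyUpTo a i ∷ʳ leastPosNotIn (map (valueIn (applyUpTo a i)) (legalIdxLists m i))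
      ≡⟨ cong (applyUpTo a i ∷ʳ_) (leastPosNotIn-values i) ⟩
    applyUpTo a i ∷ʳ a i
      ≡⟨ applyUpTo-∷ʳ a i ⟩
    applyUpTo a (suc i) ∎
    where open ≡-Reasoning

  mgonal≡a : ∀ i → mgonal m i ≡ a i
  mgonal≡a i = trans (cong (λ P → valueIn P [ i ]) (prefix≡ (suc i))) (valueIn-applyUpTo-[] a (n<1+n i))

  Decomp : ℕ → ℕ → Set
  Decomp k z = ∃[ ys ] Legal (suc z) ys × length ys ≡ k × value ys ≡ z

  decomp : Legal i ys → Decomp (length ys) (value ys)
  decomp l = _ , legal-bound l , refl , refl

  decompWith?⇔ : T (decompWith? m k z) ⇔ Decomp k z
  decompWith?⇔ {k} {z} = mk⇔ to from
    where
    test? : ∀ ys → Dec (length ys ≡ k × sum (map (mgonal m) ys) ≡ z)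
    test? ys = (length ys ≟ k) ×-dec (sum (map (mgonal m) ys) ≟ z)
    sum-mgonal : ∀ ys → sum (map (mgonal m) ys) ≡ value ys
    sum-mgonal ys = cong sum (map-cong mgonal≡a ys)
    to : T (decompWith? m k z) → Decomp k z
    to t with find (any⁻ (does ∘ test?) _ t)
    ... | ys , ys∈ , pass with Equivalence.to (T-does (test? ys)) pass
    ...   | len , sum≡ = ys , Equivalence.to ∈-legalIdxLists⇔ ys∈ , len , trans (sym (sum-mgonal ys)) sum≡
    from : Decomp k z → T (decompWith? m k z)
    from (ys , l , len , val) =
      any⁺ (does ∘ test?) (lose (Equivalence.from ∈-legalIdxLists⇔ l)
                                (Equivalence.from (T-does (test? ys)) (len , trans (sum-mgonal ys) val)))

  M≤shifted : ∀ n c w → M n ≤ suc c * M n + w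
  M≤shifted n c w = ≤-trans (m≤m+n (M n) (c * M n)) (m≤m+n _ w)

  shifted<M-suc : ∀ n → c < m → w < M n → suc c * M n + w < M (suc n)
  shifted<M-suc {c} n c<m w<M = begin-strict
    suc c * M n + _   <⟨ +-monoʳ-< (suc c * M n) w<M ⟩
    suc c * M n + M n ≤⟨ +-monoˡ-≤ (M n) (*-monoˡ-≤ (M n) c<m) ⟩
    m * M n + M n     ≡⟨ +-comm (m * M n) (M n) ⟩
    M (suc n)         ∎
    where open ≤-Reasoning

  decomp-shift⁺ : ∀ n → c < m → w < M n → Decomp k w → Decomp (suc k) (suc c * M n + w)
  decomp-shift⁺ {c} {w} n c<m w<M (ys , l , len , val) =
    subst₂ Decomp (trans (length-∷ʳ ys _) (cong suc len)) value≡ (decomp (legal-∷ʳ-idx⁺ n c<m below))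
    where
    below : Legal (suc (n * m)) ys
    below = legal-restrict l (value<a⇒All< (subst₂ _<_ (sym val) (sym (a-first n)) w<M))
    value≡ : value (ys ∷ʳ idx n c) ≡ suc c * M n + w
    value≡ = begin
      value (ys ∷ʳ idx n c)   ≡⟨ value-∷ʳ ys (idx n c) ⟩
      value ys + a (idx n c)  ≡⟨ cong₂ _+_ val (a-idx n c<m) ⟩
      w + suc c * M n         ≡⟨ +-comm w _ ⟩
      suc c * M n + w         ∎
      where open ≡-Reasoning

  decomp-shift⁻ : ∀ n → c < m → w < M n → Decomp (suc k) (suc c * M n + w) → Decomp k w
  decomp-shift⁻ {c} {w} n c<m w<M (ys , (s , lg) , len , val) with subseq-last (subseq-restrict s ys<)
    where
    ys< : All (_< suc (suc n * m)) ys
    ys< = value<a⇒All< (subst₂ _<_ (sym val) (sym (a-first (suc n))) (shifted<M-suc n c<m w<M))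
  ... | inj₁ refl = contradiction len λ ()
  ... | inj₂ (zs , x , x< , s′ , refl) with below-or-idx {n} x<
  ...   | inj₁ x<nm = ⊥-elim (<⇒≱ (value<a (subseq-mono x<nm (subseq-∷ʳ⁺ s′) , lg))
                                  (subst₂ _≤_ (sym (a-first n)) (sym val) (M≤shifted n c w)))
  ...   | inj₂ (r , r<m , refl) =
    subst₂ Decomp (suc-injective (trans (sym (length-∷ʳ zs _)) len)) value≡ (decomp below)
    where
    below : Legal (suc (n * m)) zs
    below = legal-∷ʳ-idx⁻ n r<m s′ lg
    value≡ : value zs ≡ w
    value≡ = remainder-unique {q = suc r} {q′ = suc c} {{>-nonZero (0<M n)}}
                              (subst (value zs <_) (a-first n) (value<a below)) w<M (begin
      value zs + suc r * M n   ≡⟨ cong (value zs +_) (a-idx n r<m) ⟨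
      value zs + a (idx n r)   ≡⟨ value-∷ʳ zs _ ⟨
      value (zs ∷ʳ idx n r)    ≡⟨ val ⟩
      suc c * M n + w          ≡⟨ +-comm _ w ⟩
      w + suc c * M n          ∎)
      where open ≡-Reasoning

  decompWith?-shift : ∀ n → c < m → w < M n → decompWith? m (suc k) (suc c * M n + w) ≡ decompWith? m k w
  decompWith?-shift n c<m w<M = ⇔→≡ {z = true} (mk⇔
    (to T-≡ ∘ from decompWith?⇔ ∘ decomp-shift⁻ n c<m w<M ∘ to decompWith?⇔ ∘ from T-≡)
    (to T-≡ ∘ from decompWith?⇔ ∘ decomp-shift⁺ n c<m w<M ∘ to decompWith?⇔ ∘ from T-≡))
    where open Equivalence

  p≡countBelow : ∀ n k → p m n k ≡ countBelow (decompWith? m k) (M n)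
  p≡countBelow n k = cong (countBelow (decompWith? m k)) (begin
    mgonal m (m * n + 1) ≡⟨ mgonal≡a (m * n + 1) ⟩
    a (m * n + 1)        ≡⟨ cong a (trans (+-comm (m * n) 1) (cong suc (*-comm m n))) ⟩
    a (suc (n * m))      ≡⟨ a-first n ⟩
    M n                  ∎)
    where open ≡-Reasoning

  p-suc : ∀ n k → p m (suc n) (suc k) ≡ p m n (suc k) + m * p m n k
  p-suc n k = begin
    p m (suc n) (suc k)
      ≡⟨ p≡countBelow (suc n) (suc k) ⟩
    countBelow D′ (M n + m * M n)
      ≡⟨ countBelow-+ D′ (M n) (m * M n) ⟩
    countBelow D′ (M n) + countBelow (λ w → D′ (M n + w)) (m * M n)
      ≡⟨ cong₂ _+_ (sym (p≡countBelow n (suc k))) (countBelow-* m (M n) shift) ⟩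
    p m n (suc k) + m * countBelow D (M n)
      ≡⟨ cong (λ c → p m n (suc k) + m * c) (p≡countBelow n k) ⟨
    p m n (suc k) + m * p m n k ∎
    where
    open ≡-Reasoning
    D  = decompWith? m k
    D′ = decompWith? m (suc k)
    shift : ∀ {c w} → c < m → w < M n → D′ (M n + (c * M n + w)) ≡ D w
    shift c<m w<M = trans (cong D′ (sym (+-assoc (M n) _ _))) (decompWith?-shift n c<m w<M)

proposition2p7 : (m : ℕ) → .{{_ : NonZero m}} → (n k : ℕ) → 0 < k → k < n + 1 →
    p m n k ≡ m * p m (n ∸ 1) (k ∸ 1) + p m (n ∸ 1) k
proposition2p7 m n       zero    ()
proposition2p7 m zero    (suc k) _  (s≤s ())
proposition2p7 m (suc n) (suc k) _  _ = trans (p-suc m n k) (+-comm (p m n (suc k)) (m * p m n k))
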